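{- For each $n=0,1,2,\dots$ there exist functions $r,s:\mathbb{N}\to\mathbb{N}$ with $1\le r(i)<s(i)$ for all $i$ such that, for Robin, $\mathsf{Oldest}_{RND}$ is a (surely) winning strategy in the game $RH(r,s,n+1)$ and an almost-surely losing strategy in the game $RH(r,s,n)$, where $RH(r,s,k)$ denotes the game with memory bound $b(i)=\min\{k,i\}$ (Robin remembers the bags put in on the last $k$ days).
   Context: The Robin Hood game $RH(r,s,b)$: for each $i\in\mathbb{N}$, on day $i$ the Sheriff puts $s(i)$ new distinctly labelled bags into a cave, and on night $i$ Robin removes $r(i)$ bags. The function $b$ bounds Robin's historical memory: on night $i$ Robin knows the day of each bag put in on days $i-b(i)+1,\dots,i$, but cannot distinguish among bags put in on days $1,\dots,i-b(i)$ (called very old; Robin can identify which bags are very old). Strategy $\mathsf{Oldest}_{RND}$: on night $i$, if there are at least $r(i)$ very old bags, Robin removes $r(i)$ of them chosen uniformly at random; otherwise he removes all very old bags and then removes bags from the remembered days, oldest day first, taking all bags of an earlier day before any of a later day, the bags taken from the last (partially used) day chosen uniformly at random, so that $r(i)$ bags in total are removed. The strategy is (surely) winning if every bag is eventually removed with certainty. For a bag $x$, $p_x$ is the probability (over Robin's coin tosses) that $x$ is never removed; the strategy is almost-surely losing if $\sup_x p_x=1$. -}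

module Defs where

open import Data.Nat as ℕ using (ℕ; zero; suc; _+_; _∸_; _≤_; _<_; _≤?_; _≟_)
open import Data.Integer as ℤ using (ℤ)
open import Data.Rational as ℚ using (ℚ; 0ℚ; 1ℚ)
open import Data.List using (List; []; _∷_; _++_; map; length; filter; upTo; foldr)
import Data.Product.Properties
open import Data.List.Membership.DecPropositional (Data.Product.Properties.≡-dec ℕ._≟_ ℕ._≟_) using (_∈_; _∈?_)
open import Data.List.Relation.Unary.All using (All)
open import Data.Product using (_×_; _,_; proj₁; proj₂; Σ; ∃; ∃-syntax)
open import Relation.Nullary using (¬_; does; yes; no)
open import Relation.Nullary.Decidable using (¬?)
open import Data.Bool using (Bool; true; false; if_then_else_)

-- CONVENTIONS: days/nights are 0-indexed here: our day/night i is the paper's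
-- day/night i+1 (so r i, s i here are the paper's r(i+1), s(i+1)).
-- A bag is labelled (d , j): put in on (0-indexed) day d, the j-th bag of that day (j < s d).
Bag : Set
Bag = ℕ × ℕ

day : Bag → ℕ
day = proj₁

ValidBag : (s : ℕ → ℕ) → Bag → Set
ValidBag s (d , j) = j < s d

newBags : (s : ℕ → ℕ) → ℕ → List Bag
newBags s i = map (λ j → (i , j)) (upTo (s i))

-- All ways of removing a k-subset from a list (of distinct elements):
-- returns the list of what remains, one entry per k-subset (each subset exactly once).
-- Choosing uniformly from this list = removing k elements uniformly at random.
rests : {A : Set} → ℕ → List A → List (List A)
rests zero xs = xs ∷ []
rests (suc k) [] = []
rests (suc k) (x ∷ xs) = rests k xs ++ map (x ∷_) (rests (suc k) xs)

ofDay : ℕ → List Bag → List Bag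
ofDay d = filter (λ b → proj₁ b ≟ d)

notOfDay : ℕ → List Bag → List Bag
notOfDay d = filter (λ b → ¬? (proj₁ b ≟ d))

-- Result: list of equiprobable remainders.
oldestFirst : ℕ → List ℕ → List Bag → List (List Bag)
oldestFirst m [] B = B ∷ []   -- (never reached in the games considered: enough bags)
oldestFirst m (d ∷ ds) B with m ≤? length (ofDay d B)
... | yes _ = map (_++ notOfDay d B) (rests m (ofDay d B))
... | no _ = oldestFirst (m ∸ length (ofDay d B)) ds (notOfDay d B)

-- Memory bound b(i) = min{k,i} (paper indexing). On (0-indexed) night i a bag of
-- (0-indexed) day d is very old iff d + k ≤ i.
veryOld : (k i : ℕ) → List Bag → List Bag
veryOld k i = filter (λ b → proj₁ b + k ≤? i)

remembered : (k i : ℕ) → List Bag → List Bag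
remembered k i = filter (λ b → ¬? (proj₁ b + k ≤? i))

-- remembered days on night i, ascending: (i+1) ∸ k , … , i
rememberedDays : (k i : ℕ) → List ℕ
rememberedDays k i = map (λ t → (suc i ∸ k) + t) (upTo (suc i ∸ (suc i ∸ k)))

-- Strategy Oldest_RND on night i in game RH(r,s,k), applied to cave content C:
-- the list of equiprobable possible cave contents after the night.
oldestRND : (r : ℕ → ℕ) (k i : ℕ) → List Bag → List (List Bag)
oldestRND r k i C with r i ≤? length (veryOld k i C)
... | yes _ = map (_++ remembered k i C) (rests (r i) (veryOld k i C))
... | no _ = oldestFirst (r i ∸ length (veryOld k i C)) (rememberedDays k i) (remembered k i C)

avg : List ℚ → ℚ
avg xs with length xs
... | zero  = 0ℚ
... | suc n = foldr ℚ._+_ 0ℚ xs ℚ.* (ℤ.+ 1 ℚ./ suc n)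

-- Probability that predicate f holds of the cave content after n more nights,
-- starting before day i with cave content C.
prob : (r s : ℕ → ℕ) (k : ℕ) → ℕ → ℕ → List Bag → (List Bag → ℚ) → ℚ
prob r s k zero i C f = f C
prob r s k (suc n) i C f = avg (map (λ C' → prob r s k n (suc i) C' f) (oldestRND r k i (C ++ newBags s i)))

Always : (r s : ℕ → ℕ) (k : ℕ) → ℕ → ℕ → List Bag → (List Bag → Set) → Set
Always r s k zero i C P = P C
Always r s k (suc n) i C P = All (λ C' → Always r s k n (suc i) C' P) (oldestRND r k i (C ++ newBags s i))

present : Bag → List Bag → ℚ
present x C = if does (x ∈? C) then 1ℚ else 0ℚ

-- Probability that bag x has not been removed during the first N nights
-- (meaningful for day x < N, i.e. after x has been put in).
survives : (r s : ℕ → ℕ) (k : ℕ) → Bag → ℕ → ℚ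
survives r s k x N = prob r s k N 0 [] (present x)

-- Oldest_RND is (surely) winning in RH(r,s,k): every bag is removed, whatever the coin tosses.
-- (Finite-horizon form: some night N after x's day by which x is gone in every play;
--  by König's lemma, the game tree being finitely branching, this is equivalent to
--  "in every infinite play x is eventually removed".)
SurelyWinning : (r s : ℕ → ℕ) (k : ℕ) → Set
SurelyWinning r s k = ∀ x → ValidBag s x →
  ∃[ N ] (day x < N × Always r s k N 0 [] (λ C → ¬ (x ∈ C)))

-- Oldest_RND is almost-surely losing in RH(r,s,k): sup_x p_x = 1, where
-- p_x = P(x never removed) = inf_{N > day x} survives x N (decreasing limit).
-- sup_x p_x = 1  ⇔  ∀ ε > 0 ∃ x ∀ N > day x, survives x N ≥ 1 - ε.
AlmostSurelyLosing : (r s : ℕ → ℕ) (k : ℕ) → Set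
AlmostSurelyLosing r s k = ∀ (ε : ℚ) → 0ℚ ℚ.< ε →
  ∃[ x ] (ValidBag s x × (∀ N → day x < N → 1ℚ ℚ.- ε ℚ.≤ survives r s k x N))

{-# OPTIONS --safe #-}
module Submission where

-- Let S m be the number of bags put in before day m and take r i = S (i ∸ n) + 1, with s huge.
--
-- Memory n + 1: on night i the very old bags were put in before day i ∸ n, so there are fewer
-- than r i of them. Robin removes all of them every night, hence every bag is gone at the
-- latest n + 1 nights after its day.
--
-- Memory n: before night n Robin removes a single bag of day 0 per night, and afterwards only
-- very old bags, so a remembered day j still holds at least s j ∸ i bags on night i. On night
-- i ≥ n the day i ∸ n has just become very old, so there are at least s (i ∸ n) ∸ i ≥ 2 ^ i * r i
-- very old bags, of which Robin removes r i uniformly at random: a given very old bag is taken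
-- with probability at most 2 ^ -i. For M ≥ 1 the bag (M , 0) is very old from night M + n on, so it is
-- never removed with probability at least 1 - 2 ^ (1 - M - n).

open import Data.Nat as ℕ using (ℕ; zero; suc; pred; _+_; _*_; _∸_; _^_; _⊔_; _≤_; _<_; _≤?_; _<?_; z≤n; s≤s)
open import Data.Nat.Properties
open import Data.Nat.Combinatorics using (nC1≡n; nCk+nC[k+1]≡[n+1]C[k+1]) renaming (_C_ to _choose_)
open import Data.Nat.Divisibility using (∣1⇒≡1)
import Data.Nat.Solver as ℕ
open import Data.Integer as ℤ using (+≤+)
import Data.Integer.Properties as ℤ
import Data.Rational as ℚ
import Data.Rational.Properties as ℚ
import Data.Rational.Solver as ℚ
open import Data.Rational using (ℚ; mkℚ; 0ℚ; 1ℚ; ½; 1/_; *≤*; *<*)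
open import Data.List using (List; []; _∷_; _++_; map; length; filter; foldr; upTo)
open import Data.List.Properties
  using (filter-++; length-++; length-map; length-upTo; filter-some; filter-none; filter-all)
open import Data.List.Relation.Unary.All as All using (All; [])
open import Data.List.Relation.Unary.Any using (Any; here; there)
open import Data.List.Relation.Unary.AllPairs using ([]; _∷_)
open import Data.List.Relation.Unary.Unique.Propositional using (Unique)
import Data.List.Relation.Unary.Unique.Propositional.Properties as Unique
open import Data.List.Membership.Propositional using (_∈_)
open import Data.List.Membership.Propositional.Properties
  using (∈-map⁻; ∈-map⁺; ∈-++⁻; ∈-++⁺ˡ; ∈-++⁺ʳ; ∈-upTo⁺; ∈-filter⁺; ∈-filter⁻)
import Data.List.Membership.DecPropositional as DecMembership
open import Data.Product using (_×_; _,_; proj₁; proj₂; ∃; ∃-syntax)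
open import Data.Product.Properties using (≡-dec; ,-injectiveʳ)
open import Data.Sum using (inj₁; inj₂)
open import Data.Bool using (true; false)
open import Data.Unit using (tt)
open import Function using (_∘_; case_of_)
open import Level using (0ℓ)
open import Relation.Nullary using (¬_; Dec; yes; no; does; contradiction)
open import Relation.Unary using (Pred; Decidable; _⊆_)
open import Relation.Unary.Properties using (∁?; U?)
open import Relation.Binary.Definitions using (DecidableEquality)
open import Relation.Binary.PropositionalEquality
open import Defs

private
  variable
    A : Set

count : {P : Pred A 0ℓ} → Decidable P → List A → ℕ
count P? = length ∘ filter P?

module _ {P : Pred A 0ℓ} (P? : Decidable P) where

  count-++ : ∀ xs ys → count P? (xs ++ ys) ≡ count P? xs + count P? ys
  count-++ xs ys = trans (cong length (filter-++ P? xs ys)) (length-++ (filter P? xs))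

  count-none : ∀ xs → (∀ {z} → z ∈ xs → ¬ P z) → count P? xs ≡ 0
  count-none _ ¬P = cong length (filter-none P? (All.tabulate ¬P))

  count-all : ∀ xs → (∀ {z} → z ∈ xs → P z) → count P? xs ≡ length xs
  count-all _ allP = cong length (filter-all P? (All.tabulate allP))

  count+count-∁≡length : ∀ xs → count P? xs + count (∁? P?) xs ≡ length xs
  count+count-∁≡length []       = refl
  count+count-∁≡length (x ∷ xs) with P? x
  ... | yes _ = cong suc (count+count-∁≡length xs)
  ... | no _  = trans (+-suc _ _) (cong suc (count+count-∁≡length xs))

  count>0⇒Any : ∀ xs → 0 < count P? xs → Any P xs
  count>0⇒Any (x ∷ xs) count>0 with P? x
  ... | yes px = here px
  ... | no _   = there (count>0⇒Any xs count>0)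

module _ {P Q : Pred A 0ℓ} (P? : Decidable P) (Q? : Decidable Q) where

  count-mono : P ⊆ Q → ∀ xs → count P? xs ≤ count Q? xs
  count-mono P⊆Q []       = z≤n
  count-mono P⊆Q (x ∷ xs) with P? x | Q? x
  ... | yes _  | yes _  = s≤s (count-mono P⊆Q xs)
  ... | yes px | no ¬qx = contradiction (P⊆Q px) ¬qx
  ... | no _   | yes _  = m≤n⇒m≤1+n (count-mono P⊆Q xs)
  ... | no _   | no _   = count-mono P⊆Q xs

  count-filter : P ⊆ Q → ∀ xs → count P? (filter Q? xs) ≡ count P? xs
  count-filter P⊆Q []       = refl
  count-filter P⊆Q (x ∷ xs) with Q? x
  ... | yes _ with P? x
  ...   | yes _ = cong suc (count-filter P⊆Q xs)
  ...   | no _  = count-filter P⊆Q xs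
  count-filter P⊆Q (x ∷ xs) | no ¬qx with P? x
  ...   | yes px = contradiction (P⊆Q px) ¬qx
  ...   | no _   = count-filter P⊆Q xs

  count-partition : ∀ xs → count P? xs ≡ count P? (filter Q? xs) + count P? (filter (∁? Q?) xs)
  count-partition []       = refl
  count-partition (x ∷ xs) with Q? x
  ... | yes _ with P? x
  ...   | yes _ = cong suc (count-partition xs)
  ...   | no _  = count-partition xs
  count-partition (x ∷ xs) | no _ with P? x
  ...   | yes _ = trans (cong suc (count-partition xs)) (sym (+-suc _ _))
  ...   | no _  = count-partition xs

count-≤-++-filter-∁ : {P Q : Pred A 0ℓ} (P? : Decidable P) (Q? : Decidable Q) →
  (∀ {z} → P z → ¬ Q z) → ∀ R xs → count P? xs ≤ count P? (R ++ filter (∁? Q?) xs)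
count-≤-++-filter-∁ P? Q? P⇒¬Q R xs = begin
  count P? xs                                ≡⟨ count-filter P? (∁? Q?) P⇒¬Q xs ⟨
  count P? (filter (∁? Q?) xs)               ≤⟨ m≤n+m _ (count P? R) ⟩
  count P? R + count P? (filter (∁? Q?) xs)  ≡⟨ count-++ P? R _ ⟨
  count P? (R ++ filter (∁? Q?) xs)          ∎
  where open ≤-Reasoning

count-map : {B : Set} {P : Pred A 0ℓ} {Q : Pred B 0ℓ} (P? : Decidable P) (Q? : Decidable Q) (f : B → A) →
  (∀ {z} → P (f z) → Q z) → (∀ {z} → Q z → P (f z)) → ∀ xs → count P? (map f xs) ≡ count Q? xs
count-map P? Q? f to from []       = refl
count-map P? Q? f to from (x ∷ xs) with P? (f x) | Q? x
... | yes _ | yes _  = cong suc (count-map P? Q? f to from xs)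
... | yes p | no ¬q  = contradiction (to p) ¬q
... | no ¬p | yes q  = contradiction (from q) ¬p
... | no _  | no _   = count-map P? Q? f to from xs

Unique⇒count≤1 : (_≟_ : DecidableEquality A) → ∀ {x xs} → Unique xs → count (x ≟_) xs ≤ 1
Unique⇒count≤1 _≟_ []                                = z≤n
Unique⇒count≤1 _≟_ {x} {y ∷ ys} (y∉ys ∷ unique) with x ≟ y
... | yes refl = s≤s (≤-reflexive (count-none (x ≟_) ys (All.lookup y∉ys)))
... | no _     = Unique⇒count≤1 _≟_ unique

infix 4 _⊑_

record _⊑_ (xs ys : List A) : Set₁ where
  constructor count-≤⇒⊑
  field
    count-≤ : ∀ {P : Pred A 0ℓ} (P? : Decidable P) → count P? xs ≤ count P? ys

open _⊑_ public

⊑-refl : {xs : List A} → xs ⊑ xs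
⊑-refl = count-≤⇒⊑ λ _ → ≤-refl

⊑-trans : {xs ys zs : List A} → xs ⊑ ys → ys ⊑ zs → xs ⊑ zs
⊑-trans xs⊑ys ys⊑zs = count-≤⇒⊑ λ P? → ≤-trans (count-≤ xs⊑ys P?) (count-≤ ys⊑zs P?)

⊑-skip : ∀ {xs ys : List A} y → xs ⊑ ys → xs ⊑ y ∷ ys
⊑-skip {xs = xs} {ys} y xs⊑ys = count-≤⇒⊑ skip
  where
  skip : ∀ {P} (P? : Decidable P) → count P? xs ≤ count P? (y ∷ ys)
  skip P? with does (P? y)
  ... | true  = m≤n⇒m≤1+n (count-≤ xs⊑ys P?)
  ... | false = count-≤ xs⊑ys P?

⊑-keep : ∀ {xs ys : List A} y → xs ⊑ ys → y ∷ xs ⊑ y ∷ ys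
⊑-keep {xs = xs} {ys} y xs⊑ys = count-≤⇒⊑ keep
  where
  keep : ∀ {P} (P? : Decidable P) → count P? (y ∷ xs) ≤ count P? (y ∷ ys)
  keep P? with does (P? y)
  ... | true  = s≤s (count-≤ xs⊑ys P?)
  ... | false = count-≤ xs⊑ys P?

⊑-++ʳ : ∀ {xs ys : List A} zs → xs ⊑ ys → xs ++ zs ⊑ ys ++ zs
⊑-++ʳ {xs = xs} {ys} zs xs⊑ys = count-≤⇒⊑ λ P? → begin
  count P? (xs ++ zs)        ≡⟨ count-++ P? xs zs ⟩
  count P? xs + count P? zs  ≤⟨ +-monoˡ-≤ _ (count-≤ xs⊑ys P?) ⟩
  count P? ys + count P? zs  ≡⟨ count-++ P? ys zs ⟨
  count P? (ys ++ zs)        ∎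
  where open ≤-Reasoning

⊑-∈ : DecidableEquality A → ∀ {xs ys : List A} {x} → xs ⊑ ys → x ∈ xs → x ∈ ys
⊑-∈ _≟_ {ys = ys} {x} xs⊑ys x∈xs =
  count>0⇒Any (x ≟_) ys (≤-trans (filter-some (x ≟_) x∈xs) (count-≤ xs⊑ys (x ≟_)))

module _ {Q : Pred A 0ℓ} (Q? : Decidable Q) where

  filter-⊑ : ∀ xs → filter Q? xs ⊑ xs
  filter-⊑ xs = count-≤⇒⊑ λ P? → ≤-trans (m≤m+n _ _) (≤-reflexive (sym (count-partition P? Q? xs)))

  ++-filter-∁-⊑ : ∀ {R} xs → R ⊑ filter Q? xs → R ++ filter (∁? Q?) xs ⊑ xs
  ++-filter-∁-⊑ {R} xs R⊑ = count-≤⇒⊑ λ P? → begin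
    count P? (R ++ filter (∁? Q?) xs)                        ≡⟨ count-++ P? R _ ⟩
    count P? R + count P? (filter (∁? Q?) xs)                ≤⟨ +-monoˡ-≤ _ (count-≤ R⊑ P?) ⟩
    count P? (filter Q? xs) + count P? (filter (∁? Q?) xs)   ≡⟨ count-partition P? Q? xs ⟨
    count P? xs                                              ∎
    where open ≤-Reasoning

k≤n⇒nCk>0 : ∀ {n k} → k ≤ n → 0 < n choose k
k≤n⇒nCk>0 {n}     {zero}  _         = s≤s z≤n
k≤n⇒nCk>0 {suc n} {suc k} (s≤s k≤n) =
  subst (0 <_) (nCk+nC[k+1]≡[n+1]C[k+1] n k) (≤-trans (k≤n⇒nCk>0 k≤n) (m≤m+n _ _))

nCk*[1+n]≡[1+k]*[1+n]C[1+k] : ∀ n k → (n choose k) * suc n ≡ suc k * (suc n choose suc k)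
nCk*[1+n]≡[1+k]*[1+n]C[1+k] zero    zero    = refl
nCk*[1+n]≡[1+k]*[1+n]C[1+k] zero    (suc k) = sym (*-zeroʳ (2 + k))
nCk*[1+n]≡[1+k]*[1+n]C[1+k] (suc n) zero    = cong (1 *_) (sym (nC1≡n (2 + n)))
nCk*[1+n]≡[1+k]*[1+n]C[1+k] (suc n) (suc k) = begin
  (suc n choose suc k) * (2 + n)
    ≡⟨ cong (_* (2 + n)) (pascal n k) ⟨
  (n choose k + n choose suc k) * (2 + n)
    ≡⟨ solve 3 (λ a b n → (a :+ b) :* (con 2 :+ n) := a :* (con 1 :+ n) :+ b :* (con 1 :+ n) :+ (a :+ b))
               refl (n choose k) (n choose suc k) n ⟩
  (n choose k) * suc n + (n choose suc k) * suc n + (n choose k + n choose suc k)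
    ≡⟨ cong₂ _+_ (cong₂ _+_ (nCk*[1+n]≡[1+k]*[1+n]C[1+k] n k) (nCk*[1+n]≡[1+k]*[1+n]C[1+k] n (suc k))) (pascal n k) ⟩
  suc k * (suc n choose suc k) + (2 + k) * (suc n choose (2 + k)) + suc n choose suc k
    ≡⟨ solve 3 (λ a b k → (con 1 :+ k) :* a :+ (con 2 :+ k) :* b :+ a := (con 2 :+ k) :* (a :+ b))
               refl (suc n choose suc k) (suc n choose (2 + k)) k ⟩
  (2 + k) * (suc n choose suc k + suc n choose (2 + k))
    ≡⟨ cong ((2 + k) *_) (pascal (suc n) (suc k)) ⟩
  (2 + k) * ((2 + n) choose (2 + k))
    ∎
  where
  open ≡-Reasoning
  open ℕ.+-*-Solver
  pascal : ∀ n k → n choose k + n choose suc k ≡ suc n choose suc k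
  pascal = nCk+nC[k+1]≡[n+1]C[k+1]

rests-⊑ : ∀ k (xs : List A) {R} → R ∈ rests k xs → R ⊑ xs
rests-⊑ zero    xs       (here refl) = ⊑-refl
rests-⊑ (suc k) (x ∷ xs) R∈ with ∈-++⁻ (rests k xs) R∈
... | inj₁ R∈′ = ⊑-skip x (rests-⊑ k xs R∈′)
... | inj₂ R∈′ with ∈-map⁻ (x ∷_) R∈′
...   | R′ , R′∈ , refl = ⊑-keep x (rests-⊑ (suc k) xs R′∈)

∈-rests⇒length : ∀ k (xs : List A) {R} → R ∈ rests k xs → length R + k ≡ length xs
∈-rests⇒length zero    xs       (here refl) = +-identityʳ _
∈-rests⇒length (suc k) (x ∷ xs) R∈ with ∈-++⁻ (rests k xs) R∈
... | inj₁ R∈′ = trans (+-suc _ _) (cong suc (∈-rests⇒length k xs R∈′))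
... | inj₂ R∈′ with ∈-map⁻ (x ∷_) R∈′
...   | R′ , R′∈ , refl = cong suc (∈-rests⇒length (suc k) xs R′∈)

length-rests : ∀ k (xs : List A) → length (rests k xs) ≡ length xs choose k
length-rests zero    xs       = refl
length-rests (suc k) []       = refl
length-rests (suc k) (x ∷ xs) = begin
  length (rests k xs ++ map (x ∷_) (rests (suc k) xs))
    ≡⟨ length-++ (rests k xs) ⟩
  length (rests k xs) + length (map (x ∷_) (rests (suc k) xs))
    ≡⟨ cong₂ _+_ (length-rests k xs) (trans (length-map (x ∷_) (rests (suc k) xs)) (length-rests (suc k) xs)) ⟩
  length xs choose k + length xs choose suc k
    ≡⟨ nCk+nC[k+1]≡[n+1]C[k+1] (length xs) k ⟩
  suc (length xs) choose suc k
    ∎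
  where open ≡-Reasoning

rests-nonempty : ∀ k (xs : List A) → k ≤ length xs → 0 < length (rests k xs)
rests-nonempty k xs k≤ = subst (0 <_) (sym (length-rests k xs)) (k≤n⇒nCk>0 k≤)

module _ (_≟_ : DecidableEquality A) where

  open DecMembership _≟_ using (_∈?_)

  count-rests-∋ : ∀ {x} k xs → x ∈ xs → count (x ≟_) xs ≤ 1 →
                  count (x ∈?_) (rests k xs) ≡ (length xs ∸ 1) choose k
  count-rests-∋ {x} zero xs x∈xs _ with x ∈? xs
  ... | yes _   = refl
  ... | no x∉xs = contradiction x∈xs x∉xs
  count-rests-∋ {x} (suc k) (y ∷ ys) x∈ once with x ≟ y
  ... | yes refl = begin
    count (x ∈?_) (rests k ys ++ map (x ∷_) (rests (suc k) ys))
      ≡⟨ count-++ (x ∈?_) (rests k ys) _ ⟩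
    count (x ∈?_) (rests k ys) + count (x ∈?_) (map (x ∷_) (rests (suc k) ys))
      ≡⟨ cong₂ _+_ (count-none (x ∈?_) (rests k ys) (λ R∈ → x∉ys ∘ ⊑-∈ _≟_ (rests-⊑ k ys R∈)))
                   (count-all (x ∈?_) (map (x ∷_) (rests (suc k) ys)) (λ R∈ → case ∈-map⁻ (x ∷_) R∈ of λ where
                     (_ , _ , refl) → here refl)) ⟩
    length (map (x ∷_) (rests (suc k) ys))
      ≡⟨ trans (length-map (x ∷_) (rests (suc k) ys)) (length-rests (suc k) ys) ⟩
    length ys choose suc k
      ∎
    where
    open ≡-Reasoning
    x∉ys : ¬ x ∈ ys
    x∉ys x∈ys = <⇒≱ (s≤s (filter-some (x ≟_) x∈ys)) once
  ... | no x≢y = keep-in-tail ys (tail x∈) once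
    where
    tail : ∀ {R} → x ∈ y ∷ R → x ∈ R
    tail (here x≡y)   = contradiction x≡y x≢y
    tail (there x∈R) = x∈R
    keep-in-tail : ∀ zs → x ∈ zs → count (x ≟_) zs ≤ 1 →
      count (x ∈?_) (rests k zs ++ map (y ∷_) (rests (suc k) zs)) ≡ length zs choose suc k
    keep-in-tail zs@(_ ∷ zs′) x∈zs once′ = begin
      count (x ∈?_) (rests k zs ++ map (y ∷_) (rests (suc k) zs))
        ≡⟨ count-++ (x ∈?_) (rests k zs) _ ⟩
      count (x ∈?_) (rests k zs) + count (x ∈?_) (map (y ∷_) (rests (suc k) zs))
        ≡⟨ cong (count (x ∈?_) (rests k zs) +_) (count-map (x ∈?_) (x ∈?_) (y ∷_) tail there (rests (suc k) zs)) ⟩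
      count (x ∈?_) (rests k zs) + count (x ∈?_) (rests (suc k) zs)
        ≡⟨ cong₂ _+_ (count-rests-∋ k zs x∈zs once′) (count-rests-∋ (suc k) zs x∈zs once′) ⟩
      length zs′ choose k + length zs′ choose suc k
        ≡⟨ nCk+nC[k+1]≡[n+1]C[k+1] (length zs′) k ⟩
      length zs choose suc k
        ∎
      where open ≡-Reasoning

  count-rests-∌ : ∀ {x} k xs → x ∈ xs → count (x ≟_) xs ≤ 1 →
                  count (∁? (x ∈?_)) (rests (suc k) xs) ≡ (length xs ∸ 1) choose k
  count-rests-∌ {x} k xs@(_ ∷ ys) x∈xs once = +-cancelˡ-≡ (length ys choose suc k) _ _ (begin
    length ys choose suc k + count (∁? (x ∈?_)) Rs
      ≡⟨ cong (_+ count (∁? (x ∈?_)) Rs) (count-rests-∋ (suc k) xs x∈xs once) ⟨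
    count (x ∈?_) Rs + count (∁? (x ∈?_)) Rs
      ≡⟨ count+count-∁≡length (x ∈?_) Rs ⟩
    length Rs
      ≡⟨ length-rests (suc k) xs ⟩
    suc (length ys) choose suc k
      ≡⟨ nCk+nC[k+1]≡[n+1]C[k+1] (length ys) k ⟨
    length ys choose k + length ys choose suc k
      ≡⟨ +-comm (length ys choose k) _ ⟩
    length ys choose suc k + length ys choose k
      ∎)
    where
    open ≡-Reasoning
    Rs : List (List A)
    Rs = rests (suc k) xs

  count-rests-∌*e≤length-rests : ∀ {x} k xs e → x ∈ xs → count (x ≟_) xs ≤ 1 → e * suc k ≤ length xs →
                                 count (∁? (x ∈?_)) (rests (suc k) xs) * e ≤ length (rests (suc k) xs)
  count-rests-∌*e≤length-rests {x} k xs@(_ ∷ ys) e x∈xs once e*[1+k]≤ = *-cancelʳ-≤ _ _ (suc k) (begin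
    count (∁? (x ∈?_)) (rests (suc k) xs) * e * suc k  ≡⟨ cong (λ c → c * e * suc k) (count-rests-∌ k xs x∈xs once) ⟩
    (length ys choose k) * e * suc k                   ≡⟨ *-assoc (length ys choose k) e (suc k) ⟩
    (length ys choose k) * (e * suc k)                 ≤⟨ *-monoʳ-≤ (length ys choose k) e*[1+k]≤ ⟩
    (length ys choose k) * length xs                   ≡⟨ nCk*[1+n]≡[1+k]*[1+n]C[1+k] (length ys) k ⟩
    suc k * (length xs choose suc k)                   ≡⟨ *-comm (suc k) _ ⟩
    (length xs choose suc k) * suc k                   ≡⟨ cong (_* suc k) (length-rests (suc k) xs) ⟨
    length (rests (suc k) xs) * suc k                  ∎)
    where open ≤-Reasoning

fromℕ : ℕ → ℚ
fromℕ n = mkℚ (ℤ.+ n) 0 (λ (_ , 1∣n) → ∣1⇒≡1 1∣n)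

fromℕ-+ : ∀ m n → fromℕ (m + n) ≡ fromℕ m ℚ.+ fromℕ n
fromℕ-+ m n = trans (sym (ℚ.↥p/↧p≡p (fromℕ (m + n)))) (cong (ℚ._/ 1) (begin
  ℤ.+ (m + n)                             ≡⟨ ℤ.pos-+ m n ⟩
  ℤ.+ m ℤ.+ ℤ.+ n                         ≡⟨ cong₂ ℤ._+_ (ℤ.*-identityʳ (ℤ.+ m)) (ℤ.*-identityʳ (ℤ.+ n)) ⟨
  ℤ.+ m ℤ.* ℤ.+ 1 ℤ.+ ℤ.+ n ℤ.* ℤ.+ 1     ∎))
  where open ≡-Reasoning

fromℕ-* : ∀ m n → fromℕ (m * n) ≡ fromℕ m ℚ.* fromℕ n
fromℕ-* m n = trans (sym (ℚ.↥p/↧p≡p (fromℕ (m * n)))) (cong (ℚ._/ 1) (ℤ.pos-* m n))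

fromℕ-mono-≤ : ∀ {m n} → m ≤ n → fromℕ m ℚ.≤ fromℕ n
fromℕ-mono-≤ {m} {n} m≤n =
  *≤* (subst₂ ℤ._≤_ (sym (ℤ.*-identityʳ (ℤ.+ m))) (sym (ℤ.*-identityʳ (ℤ.+ n))) (+≤+ m≤n))

fromℕ-nonNeg : ∀ n → 0ℚ ℚ.≤ fromℕ n
fromℕ-nonNeg n = fromℕ-mono-≤ z≤n

fromℕ[1+n]*1/[1+n]≡1 : ∀ n → fromℕ (suc n) ℚ.* (ℤ.+ 1 ℚ./ suc n) ≡ 1ℚ
fromℕ[1+n]*1/[1+n]≡1 n =
  trans (cong (fromℕ (suc n) ℚ.*_) (ℚ.↥p/↧p≡p (1/ fromℕ (suc n)))) (ℚ.*-inverseʳ (fromℕ (suc n)))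

1/[1+n]-nonNeg : ∀ n → 0ℚ ℚ.≤ ℤ.+ 1 ℚ./ suc n
1/[1+n]-nonNeg n = subst (0ℚ ℚ.≤_) (sym (ℚ.↥p/↧p≡p (1/ fromℕ (suc n)))) (*≤* (+≤+ z≤n))

sumℚ : List ℚ → ℚ
sumℚ = foldr ℚ._+_ 0ℚ

avg≡sumℚ*1/[1+n] : ∀ xs {n} → length xs ≡ suc n → avg xs ≡ sumℚ xs ℚ.* (ℤ.+ 1 ℚ./ suc n)
avg≡sumℚ*1/[1+n] xs eq with length xs | eq
... | .(suc _) | refl = refl

sumℚ-nonNeg : ∀ xs → (∀ {v} → v ∈ xs → 0ℚ ℚ.≤ v) → 0ℚ ℚ.≤ sumℚ xs
sumℚ-nonNeg []       _      = ℚ.≤-refl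
sumℚ-nonNeg (x ∷ xs) nonNeg = ℚ.+-mono-≤ (nonNeg (here refl)) (sumℚ-nonNeg xs (nonNeg ∘ there))

avg-nonNeg : ∀ xs → (∀ {v} → v ∈ xs → 0ℚ ℚ.≤ v) → 0ℚ ℚ.≤ avg xs
avg-nonNeg xs nonNeg with length xs
... | zero  = ℚ.≤-refl
... | suc n = ℚ.≤-trans (ℚ.≤-reflexive (sym (ℚ.*-zeroˡ (ℤ.+ 1 ℚ./ suc n))))
  (ℚ.*-monoʳ-≤-nonNeg (ℤ.+ 1 ℚ./ suc n) {{ℚ.nonNegative (1/[1+n]-nonNeg n)}} (sumℚ-nonNeg xs nonNeg))

module _ {A : Set} (h : A → ℚ) (h-nonNeg : ∀ o → 0ℚ ℚ.≤ h o) where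

  sumℚ-map-≥ : ∀ {G : Pred A 0ℓ} (G? : Decidable G) L os →
               (∀ {o} → o ∈ os → G o → L ℚ.≤ h o) → fromℕ (count G? os) ℚ.* L ℚ.≤ sumℚ (map h os)
  sumℚ-map-≥ G? L [] _ = ℚ.≤-reflexive (ℚ.*-zeroˡ L)
  sumℚ-map-≥ G? L (o ∷ os) good with G? o
  ... | yes Go = begin
    fromℕ (suc (count G? os)) ℚ.* L
      ≡⟨ cong (ℚ._* L) (fromℕ-+ 1 (count G? os)) ⟩
    (1ℚ ℚ.+ fromℕ (count G? os)) ℚ.* L
      ≡⟨ solve 2 (λ c L → (con 1ℚ :+ c) :* L := L :+ c :* L) refl (fromℕ (count G? os)) L ⟩
    L ℚ.+ fromℕ (count G? os) ℚ.* L
      ≤⟨ ℚ.+-mono-≤ (good (here refl) Go) (sumℚ-map-≥ G? L os (good ∘ there)) ⟩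
    h o ℚ.+ sumℚ (map h os)
      ∎
    where
    open ℚ.≤-Reasoning
    open ℚ.+-*-Solver
  ... | no _ = begin
    fromℕ (count G? os) ℚ.* L              ≡⟨ ℚ.+-identityˡ _ ⟨
    0ℚ ℚ.+ fromℕ (count G? os) ℚ.* L       ≤⟨ ℚ.+-mono-≤ (h-nonNeg o) (sumℚ-map-≥ G? L os (good ∘ there)) ⟩
    h o ℚ.+ sumℚ (map h os)                ∎
    where open ℚ.≤-Reasoning

  avg-map-≥ : ∀ {G : Pred A 0ℓ} (G? : Decidable G) L a os → L ℚ.≤ 1ℚ →
              (∀ {o} → o ∈ os → G o → L ℚ.≤ h o) → 0 < length os →
              fromℕ (count (∁? G?) os) ℚ.≤ fromℕ (length os) ℚ.* a → L ℚ.- a ℚ.≤ avg (map h os)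
  avg-map-≥ G? L a os L≤1 good os≢[] few-bad with length os in len
  ... | suc n = begin
    L ℚ.- a                          ≡⟨ L-a≡[N*L-N*a]*w ⟩
    (N ℚ.* L ℚ.- N ℚ.* a) ℚ.* w      ≤⟨ ℚ.*-monoʳ-≤-nonNeg w {{ℚ.nonNegative (1/[1+n]-nonNeg n)}} N*L-N*a≤sum ⟩
    sumℚ (map h os) ℚ.* w            ≡⟨ avg≡sumℚ*1/[1+n] (map h os) (trans (length-map h os) len) ⟨
    avg (map h os)                   ∎
    where
    open ℚ.≤-Reasoning
    open ℚ.+-*-Solver
    N w g b : ℚ
    N = fromℕ (suc n)
    w = ℤ.+ 1 ℚ./ suc n
    g = fromℕ (count G? os)
    b = fromℕ (count (∁? G?) os)
    N≡g+b : N ≡ g ℚ.+ b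
    N≡g+b = trans (cong fromℕ (trans (sym len) (sym (count+count-∁≡length G? os))))
                  (fromℕ-+ (count G? os) (count (∁? G?) os))
    L-a≡[N*L-N*a]*w : L ℚ.- a ≡ (N ℚ.* L ℚ.- N ℚ.* a) ℚ.* w
    L-a≡[N*L-N*a]*w = begin-equality
      L ℚ.- a
        ≡⟨ ℚ.*-identityʳ (L ℚ.- a) ⟨
      (L ℚ.- a) ℚ.* 1ℚ
        ≡⟨ cong ((L ℚ.- a) ℚ.*_) (fromℕ[1+n]*1/[1+n]≡1 n) ⟨
      (L ℚ.- a) ℚ.* (N ℚ.* w)
        ≡⟨ solve 4 (λ N L a w → (L :- a) :* (N :* w) := (N :* L :- N :* a) :* w) refl N L a w ⟩
      (N ℚ.* L ℚ.- N ℚ.* a) ℚ.* w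
        ∎
    b*L≤N*a : b ℚ.* L ℚ.≤ N ℚ.* a
    b*L≤N*a = begin
      b ℚ.* L                          ≤⟨ ℚ.*-monoˡ-≤-nonNeg b {{ℚ.nonNegative (fromℕ-nonNeg _)}} L≤1 ⟩
      b ℚ.* 1ℚ                         ≡⟨ ℚ.*-identityʳ b ⟩
      b                                ≤⟨ few-bad ⟩
      N ℚ.* a                          ∎
    N*L-N*a≤sum : N ℚ.* L ℚ.- N ℚ.* a ℚ.≤ sumℚ (map h os)
    N*L-N*a≤sum = begin
      N ℚ.* L ℚ.- N ℚ.* a
        ≡⟨ cong (λ M → M ℚ.* L ℚ.- N ℚ.* a) N≡g+b ⟩
      (g ℚ.+ b) ℚ.* L ℚ.- N ℚ.* a
        ≡⟨ solve 4 (λ g b L Na → (g :+ b) :* L :- Na := g :* L :+ (b :* L :- Na)) refl g b L (N ℚ.* a) ⟩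
      g ℚ.* L ℚ.+ (b ℚ.* L ℚ.- N ℚ.* a)
        ≤⟨ ℚ.+-monoʳ-≤ (g ℚ.* L) (ℚ.+-monoˡ-≤ (ℚ.- (N ℚ.* a)) b*L≤N*a) ⟩
      g ℚ.* L ℚ.+ (N ℚ.* a ℚ.- N ℚ.* a)
        ≡⟨ cong (g ℚ.* L ℚ.+_) (ℚ.+-inverseʳ (N ℚ.* a)) ⟩
      g ℚ.* L ℚ.+ 0ℚ
        ≡⟨ ℚ.+-identityʳ (g ℚ.* L) ⟩
      g ℚ.* L
        ≤⟨ sumℚ-map-≥ G? L os good ⟩
      sumℚ (map h os)
        ∎

  avg-map-≥-all : ∀ L os → L ℚ.≤ 1ℚ → (∀ {o} → o ∈ os → L ℚ.≤ h o) → 0 < length os →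
                  L ℚ.≤ avg (map h os)
  avg-map-≥-all L os L≤1 good os≢[] = subst (ℚ._≤ avg (map h os)) (ℚ.+-identityʳ L)
    (avg-map-≥ U? L 0ℚ os L≤1 (λ o∈ _ → good o∈) os≢[] no-bad)
    where
    no-bad : fromℕ (count (∁? U?) os) ℚ.≤ fromℕ (length os) ℚ.* 0ℚ
    no-bad = subst₂ ℚ._≤_ (cong fromℕ (sym (count-none (∁? U?) os (λ _ ¬⊤ → ¬⊤ tt))))
                          (sym (ℚ.*-zeroʳ (fromℕ (length os)))) ℚ.≤-refl

infix 8 ½^_

½^_ : ℕ → ℚ
½^ zero  = 1ℚ
½^ suc n = ½ ℚ.* ½^ n

½^-nonNeg : ∀ n → 0ℚ ℚ.≤ ½^ n
½^-nonNeg zero    = *≤* (+≤+ z≤n)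
½^-nonNeg (suc n) = ℚ.*-monoˡ-≤-nonNeg ½ (½^-nonNeg n)

½^[1+n]+½^[1+n]≡½^n : ∀ n → ½^ suc n ℚ.+ ½^ suc n ≡ ½^ n
½^[1+n]+½^[1+n]≡½^n n = trans (sym (ℚ.*-distribʳ-+ (½^ n) ½ ½)) (ℚ.*-identityˡ (½^ n))

fromℕ[2^n]*½^n≡1 : ∀ n → fromℕ (2 ^ n) ℚ.* ½^ n ≡ 1ℚ
fromℕ[2^n]*½^n≡1 zero    = refl
fromℕ[2^n]*½^n≡1 (suc n) = begin
  fromℕ (2 * 2 ^ n) ℚ.* (½ ℚ.* ½^ n)
    ≡⟨ cong (ℚ._* (½ ℚ.* ½^ n)) (fromℕ-* 2 (2 ^ n)) ⟩
  fromℕ 2 ℚ.* fromℕ (2 ^ n) ℚ.* (½ ℚ.* ½^ n)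
    ≡⟨ solve 4 (λ t p h q → t :* p :* (h :* q) := (t :* h) :* (p :* q)) refl (fromℕ 2) (fromℕ (2 ^ n)) ½ (½^ n) ⟩
  (fromℕ 2 ℚ.* ½) ℚ.* (fromℕ (2 ^ n) ℚ.* ½^ n)
    ≡⟨ cong (1ℚ ℚ.*_) (fromℕ[2^n]*½^n≡1 n) ⟩
  1ℚ ℚ.* 1ℚ
    ∎
  where
  open ≡-Reasoning
  open ℚ.+-*-Solver

m*2^i≤n⇒m≤n*½^i : ∀ m n i → m * 2 ^ i ≤ n → fromℕ m ℚ.≤ fromℕ n ℚ.* ½^ i
m*2^i≤n⇒m≤n*½^i m n i m*2^i≤n = begin
  fromℕ m
    ≡⟨ ℚ.*-identityʳ (fromℕ m) ⟨
  fromℕ m ℚ.* 1ℚ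
    ≡⟨ cong (fromℕ m ℚ.*_) (fromℕ[2^n]*½^n≡1 i) ⟨
  fromℕ m ℚ.* (fromℕ (2 ^ i) ℚ.* ½^ i)
    ≡⟨ ℚ.*-assoc (fromℕ m) (fromℕ (2 ^ i)) (½^ i) ⟨
  fromℕ m ℚ.* fromℕ (2 ^ i) ℚ.* ½^ i
    ≡⟨ cong (ℚ._* ½^ i) (fromℕ-* m (2 ^ i)) ⟨
  fromℕ (m * 2 ^ i) ℚ.* ½^ i
    ≤⟨ ℚ.*-monoʳ-≤-nonNeg (½^ i) {{ℚ.nonNegative (½^-nonNeg i)}} (fromℕ-mono-≤ m*2^i≤n) ⟩
  fromℕ n ℚ.* ½^ i
    ∎
  where open ℚ.≤-Reasoning

n<2^n : ∀ n → n < 2 ^ n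
n<2^n zero    = s≤s z≤n
n<2^n (suc n) = +-mono-≤-< (m^n>0 2 n) (<-≤-trans (n<2^n n) (m≤m+n _ 0))

½^n+½^n-eventually-≤ : ∀ ε → 0ℚ ℚ.< ε → ∃[ K ] (∀ n → K ≤ n → ½^ n ℚ.+ ½^ n ℚ.≤ ε)
½^n+½^n-eventually-≤ (mkℚ (ℤ.+ 0) _ _) (*<* (ℤ.+<+ ()))
½^n+½^n-eventually-≤ (mkℚ ℤ.-[1+ _ ] _ _) (*<* ())
½^n+½^n-eventually-≤ ε@(mkℚ (ℤ.+ suc p) d _) _ = suc d , λ n d<n → ℚ.≤-trans (≤w n d<n) w≤ε
  where
  w : ℚ
  w = 1/ fromℕ (suc d)
  w-nonNeg : 0ℚ ℚ.≤ w
  w-nonNeg = *≤* (+≤+ z≤n)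
  w≤ε : w ℚ.≤ ε
  w≤ε = *≤* (subst₂ ℤ._≤_ (ℤ.pos-* 1 (suc d)) (ℤ.pos-* (suc p) (suc d))
              (+≤+ (*-monoˡ-≤ (suc d) {1} {suc p} (s≤s z≤n))))
  ≤w : ∀ n → suc d ≤ n → ½^ n ℚ.+ ½^ n ℚ.≤ w
  ≤w n d<n = begin
    ½^ n ℚ.+ ½^ n
      ≡⟨ ℚ.*-identityʳ _ ⟨
    (½^ n ℚ.+ ½^ n) ℚ.* 1ℚ
      ≡⟨ cong ((½^ n ℚ.+ ½^ n) ℚ.*_) (ℚ.*-inverseʳ (fromℕ (suc d))) ⟨
    (½^ n ℚ.+ ½^ n) ℚ.* (fromℕ (suc d) ℚ.* w)
      ≡⟨ solve 3 (λ h D w → (h :+ h) :* (D :* w) := ((D :+ D) :* h) :* w) refl (½^ n) (fromℕ (suc d)) w ⟩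
    (fromℕ (suc d) ℚ.+ fromℕ (suc d)) ℚ.* ½^ n ℚ.* w
      ≡⟨ cong (λ D → D ℚ.* ½^ n ℚ.* w) (fromℕ-+ (suc d) (suc d)) ⟨
    fromℕ (suc d + suc d) ℚ.* ½^ n ℚ.* w
      ≤⟨ ℚ.*-monoʳ-≤-nonNeg w {{ℚ.nonNegative w-nonNeg}}
           (ℚ.*-monoʳ-≤-nonNeg (½^ n) {{ℚ.nonNegative (½^-nonNeg n)}} (fromℕ-mono-≤ 2[1+d]≤2^n)) ⟩
    fromℕ (2 ^ n) ℚ.* ½^ n ℚ.* w
      ≡⟨ cong (ℚ._* w) (fromℕ[2^n]*½^n≡1 n) ⟩
    1ℚ ℚ.* w
      ≡⟨ ℚ.*-identityˡ w ⟩
    w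
      ∎
    where
    open ℚ.≤-Reasoning
    open ℚ.+-*-Solver
    2[1+d]≤2^n : suc d + suc d ≤ 2 ^ n
    2[1+d]≤2^n = ≤-trans (+-mono-≤ (n<2^n d) (≤-trans (n<2^n d) (m≤m+n _ 0))) (^-monoʳ-≤ 2 d<n)

_≟ᵇ_ : DecidableEquality Bag
_≟ᵇ_ = ≡-dec ℕ._≟_ ℕ._≟_

day<? : ∀ m → Decidable (λ b → day b < m)
day<? m b = day b <? m

day≟ : ∀ j → Decidable (λ b → day b ≡ j)
day≟ j b = day b ℕ.≟ j

oldestRND-veryOld : ∀ r k i B → r i ≤ length (veryOld k i B) →
  oldestRND r k i B ≡ map (_++ remembered k i B) (rests (r i) (veryOld k i B))
oldestRND-veryOld r k i B r≤ with r i ≤? length (veryOld k i B)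
... | yes _ = refl
... | no r≰ = contradiction r≤ r≰

oldestRND-remembered : ∀ r k i B → length (veryOld k i B) < r i →
  oldestRND r k i B ≡ oldestFirst (r i ∸ length (veryOld k i B)) (rememberedDays k i) (remembered k i B)
oldestRND-remembered r k i B <r with r i ≤? length (veryOld k i B)
... | yes r≤ = contradiction r≤ (<⇒≱ <r)
... | no _ = refl

oldestFirst-∷ : ∀ m d ds B → m ≤ length (ofDay d B) →
  oldestFirst m (d ∷ ds) B ≡ map (_++ notOfDay d B) (rests m (ofDay d B))
oldestFirst-∷ m d ds B m≤ with m ≤? length (ofDay d B)
... | yes _ = refl
... | no m≰ = contradiction m≤ m≰

∈-oldestFirst⇒⊑ : ∀ m ds B {C} → C ∈ oldestFirst m ds B → C ⊑ B
∈-oldestFirst⇒⊑ m [] B (here refl) = ⊑-refl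
∈-oldestFirst⇒⊑ m (d ∷ ds) B C∈ with m ≤? length (ofDay d B)
... | yes _ with ∈-map⁻ (_++ notOfDay d B) C∈
...   | R , R∈ , refl = ++-filter-∁-⊑ (day≟ d) B (rests-⊑ m (ofDay d B) R∈)
∈-oldestFirst⇒⊑ m (d ∷ ds) B C∈ | no _ =
  ⊑-trans (∈-oldestFirst⇒⊑ (m ∸ length (ofDay d B)) ds (notOfDay d B) C∈) (filter-⊑ _ B)

∈-oldestRND⇒⊑ : ∀ r k i B {C} → C ∈ oldestRND r k i B → C ⊑ B
∈-oldestRND⇒⊑ r k i B C∈ with r i ≤? length (veryOld k i B)
... | yes _ with ∈-map⁻ (_++ remembered k i B) C∈
...   | R , R∈ , refl = ++-filter-∁-⊑ (λ b → day b + k ≤? i) B (rests-⊑ (r i) (veryOld k i B) R∈)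
∈-oldestRND⇒⊑ r k i B C∈ | no _ =
  ⊑-trans (∈-oldestFirst⇒⊑ _ (rememberedDays k i) (remembered k i B) C∈) (filter-⊑ _ B)

module _ (s : ℕ → ℕ) where

  day-newBags : ∀ i {y} → y ∈ newBags s i → day y ≡ i
  day-newBags i y∈ with ∈-map⁻ (i ,_) y∈
  ... | _ , _ , refl = refl

  length-newBags : ∀ i → length (newBags s i) ≡ s i
  length-newBags i = trans (length-map (i ,_) (upTo (s i))) (length-upTo (s i))

  first-∈-newBags : ∀ i → 0 < s i → (i , 0) ∈ newBags s i
  first-∈-newBags i 0<s = ∈-map⁺ (i ,_) (∈-upTo⁺ 0<s)

  bagsBefore : ℕ → List Bag
  bagsBefore zero    = []
  bagsBefore (suc i) = bagsBefore i ++ newBags s i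

  day-bagsBefore : ∀ i {y} → y ∈ bagsBefore i → day y < i
  day-bagsBefore (suc i) y∈ with ∈-++⁻ (bagsBefore i) y∈
  ... | inj₁ y∈′ = m<n⇒m<1+n (day-bagsBefore i y∈′)
  ... | inj₂ y∈′ = ≤-reflexive (cong suc (day-newBags i y∈′))

  bagsBefore-unique : ∀ i → Unique (bagsBefore i)
  bagsBefore-unique zero    = []
  bagsBefore-unique (suc i) = Unique.++⁺ (bagsBefore-unique i)
    (Unique.map⁺ ,-injectiveʳ (Unique.upTo⁺ (s i)))
    (λ (y∈old , y∈new) → <-irrefl (day-newBags i y∈new) (day-bagsBefore i y∈old))

  count-day<-bagsBefore : ∀ {m} i → m ≤ i → count (day<? m) (bagsBefore i) ≡ length (bagsBefore m)
  count-day<-bagsBefore {m} i m≤i with m≤n⇒m<n∨m≡n m≤i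
  ... | inj₂ refl = count-all (day<? m) (bagsBefore m) (day-bagsBefore m)
  count-day<-bagsBefore {m} (suc i) _ | inj₁ (s≤s m≤i) = begin
    count (day<? m) (bagsBefore i ++ newBags s i)
      ≡⟨ count-++ (day<? m) (bagsBefore i) (newBags s i) ⟩
    count (day<? m) (bagsBefore i) + count (day<? m) (newBags s i)
      ≡⟨ cong₂ _+_ (count-day<-bagsBefore i m≤i) (count-none (day<? m) (newBags s i) new-not-before-m) ⟩
    length (bagsBefore m) + 0
      ≡⟨ +-identityʳ _ ⟩
    length (bagsBefore m) ∎
    where
    open ≡-Reasoning
    new-not-before-m : ∀ {y} → y ∈ newBags s i → ¬ day y < m
    new-not-before-m y∈ = ≤⇒≯ (≤-trans m≤i (≤-reflexive (sym (day-newBags i y∈))))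

module _ (r s : ℕ → ℕ) (k : ℕ) where

  Always-invariant : ∀ {ℓ} (I : ℕ → List Bag → Set ℓ) {P : List Bag → Set} →
    (∀ {i C C′} → I i C → C′ ∈ oldestRND r k i (C ++ newBags s i) → I (suc i) C′) →
    ∀ N i C → I i C → (∀ {C′} → I (N + i) C′ → P C′) → Always r s k N i C P
  Always-invariant I I-step zero    i C inv I⇒P = I⇒P inv
  Always-invariant I I-step (suc N) i C inv I⇒P = All.tabulate λ {C′} C′∈ →
    Always-invariant I I-step N (suc i) C′ (I-step inv C′∈) λ {C″} → I⇒P ∘ subst (λ j → I j C″) (+-suc N i)

  prob-nonNeg : ∀ f → (∀ C → 0ℚ ℚ.≤ f C) → ∀ N i C → 0ℚ ℚ.≤ prob r s k N i C f
  prob-nonNeg f f-nonNeg zero    i C = f-nonNeg C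
  prob-nonNeg f f-nonNeg (suc N) i C = avg-nonNeg (map next outcomes) next-nonNeg
    where
    next : List Bag → ℚ
    next C′ = prob r s k N (suc i) C′ f
    outcomes : List (List Bag)
    outcomes = oldestRND r k i (C ++ newBags s i)
    next-nonNeg : ∀ {v} → v ∈ map next outcomes → 0ℚ ℚ.≤ v
    next-nonNeg v∈ with ∈-map⁻ next v∈
    ... | C′ , _ , refl = prob-nonNeg f f-nonNeg N (suc i) C′

module Construction (n : ℕ) where

  -- s is chosen so that s (i ∸ n) ∸ i = 2 ^ i * r i + 1 for i ≥ n.
  S s : ℕ → ℕ
  S zero    = 0
  S (suc m) = S m + s m
  s m = 2 ^ (m + n) * suc (S m) + suc (m + n)

  r : ℕ → ℕ
  r i = suc (S (i ∸ n))

  length-bagsBefore : ∀ m → length (bagsBefore s m) ≡ S m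
  length-bagsBefore zero    = refl
  length-bagsBefore (suc m) = trans (length-++ (bagsBefore s m))
    (cong₂ _+_ (length-bagsBefore m) (length-newBags s m))

  S-mono : ∀ {m m′} → m ≤ m′ → S m ≤ S m′
  S-mono {m} {zero}   z≤n = ≤-refl
  S-mono {m} {suc m′} m≤ with m≤n⇒m<n∨m≡n m≤
  ... | inj₁ (s≤s m≤m′) = ≤-trans (S-mono m≤m′) (m≤m+n (S m′) (s m′))
  ... | inj₂ refl = ≤-refl

  1≤r<s : ∀ i → 1 ≤ r i × r i < s i
  1≤r<s i = s≤s z≤n , (begin-strict
    suc (S (i ∸ n))                 ≤⟨ s≤s (S-mono (m∸n≤m i n)) ⟩
    suc (S i)                       ≤⟨ m≤n*m (suc (S i)) (2 ^ (i + n)) {{m^n≢0 2 (i + n)}} ⟩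
    2 ^ (i + n) * suc (S i)         <⟨ m<m+n _ (s≤s z≤n) ⟩
    s i                             ∎)
    where open ≤-Reasoning

module Winning (n : ℕ) where

  open Construction n

  Inv : ℕ → List Bag → Set₁
  Inv i C = C ⊑ bagsBefore s i × All (λ y → i ≤ day y + suc n) C

  veryOld? : ∀ i → Decidable (λ b → day b + suc n ≤ i)
  veryOld? i b = day b + suc n ≤? i

  veryOld-<r : ∀ i B → B ⊑ bagsBefore s (suc i) → length (veryOld (suc n) i B) < r i
  veryOld-<r i B B⊑ = s≤s (begin
    count (veryOld? i) B
      ≤⟨ count-mono (veryOld? i) (day<? (i ∸ n)) early B ⟩
    count (day<? (i ∸ n)) B
      ≤⟨ count-≤ B⊑ (day<? (i ∸ n)) ⟩
    count (day<? (i ∸ n)) (bagsBefore s (suc i))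
      ≡⟨ count-day<-bagsBefore s (suc i) (m≤n⇒m≤1+n (m∸n≤m i n)) ⟩
    length (bagsBefore s (i ∸ n))
      ≡⟨ length-bagsBefore (i ∸ n) ⟩
    S (i ∸ n)
      ∎)
    where
    open ≤-Reasoning
    early : ∀ {d} → d + suc n ≤ i → d < i ∸ n
    early {d} d+1+n≤i =
      subst (_≤ i ∸ n) (m+n∸n≡m (suc d) n) (∸-monoˡ-≤ n (subst (_≤ i) (+-suc d n) d+1+n≤i))

  Inv-step : ∀ {i C C′} → Inv i C → C′ ∈ oldestRND r (suc n) i (C ++ newBags s i) → Inv (suc i) C′
  Inv-step {i} {C} {C′} (C⊑ , _) C′∈ = ⊑-trans C′⊑B (⊑-++ʳ (newBags s i) C⊑) , All.tabulate not-veryOld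
    where
    B : List Bag
    B = C ++ newBags s i
    C′∈′ : C′ ∈ oldestFirst _ (rememberedDays (suc n) i) (remembered (suc n) i B)
    C′∈′ = subst (C′ ∈_) (oldestRND-remembered r (suc n) i B (veryOld-<r i B (⊑-++ʳ (newBags s i) C⊑))) C′∈
    C′⊑remembered : C′ ⊑ remembered (suc n) i B
    C′⊑remembered = ∈-oldestFirst⇒⊑ _ (rememberedDays (suc n) i) (remembered (suc n) i B) C′∈′
    C′⊑B : C′ ⊑ B
    C′⊑B = ⊑-trans C′⊑remembered (filter-⊑ (∁? (veryOld? i)) B)
    not-veryOld : ∀ {y} → y ∈ C′ → suc i ≤ day y + suc n
    not-veryOld y∈ = ≰⇒> (proj₂ (∈-filter⁻ (∁? (veryOld? i)) {xs = B} (⊑-∈ _≟ᵇ_ C′⊑remembered y∈)))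

  winning : SurelyWinning r s (suc n)
  winning x _ = N , s≤s (m≤m+n (day x) (suc n)) ,
    Always-invariant r s (suc n) Inv Inv-step N 0 [] (⊑-refl , []) x∉
    where
    N : ℕ
    N = suc (day x + suc n)
    x∉ : ∀ {C} → Inv (N + 0) C → ¬ x ∈ C
    x∉ (_ , late) x∈ = <-irrefl refl (≤-trans (≤-reflexive (sym (+-identityʳ N))) (All.lookup late x∈))

module Losing (n M : ℕ) (1≤M : 1 ≤ M) where

  open Construction n
  open DecMembership _≟ᵇ_ using (_∈?_)

  x : Bag
  x = M , 0

  D : ℕ
  D = M + n

  -- A remembered day has lost at most one bag per night so far.
  Inv : ℕ → List Bag → Set₁
  Inv i C = C ⊑ bagsBefore s i × (∀ j → i ∸ n ≤ j → j < i → s j ∸ i ≤ count (day≟ j) C)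

  ⊑-bagsBefore⇒count-x≤1 : ∀ i {C} → C ⊑ bagsBefore s i → count (x ≟ᵇ_) C ≤ 1
  ⊑-bagsBefore⇒count-x≤1 i C⊑ = ≤-trans (count-≤ C⊑ (x ≟ᵇ_)) (Unique⇒count≤1 _≟ᵇ_ (bagsBefore-unique s i))

  module Night (i : ℕ) (C : List Bag) (inv : Inv i C) where

    C⊑ : C ⊑ bagsBefore s i
    C⊑ = proj₁ inv

    C-count : ∀ j → i ∸ n ≤ j → j < i → s j ∸ i ≤ count (day≟ j) C
    C-count = proj₂ inv

    B : List Bag
    B = C ++ newBags s i

    V : List Bag
    V = veryOld n i B

    outcomes : List (List Bag)
    outcomes = oldestRND r n i B

    veryOld? : Decidable (λ b → day b + n ≤ i)
    veryOld? b = day b + n ≤? i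

    B⊑ : B ⊑ bagsBefore s (suc i)
    B⊑ = ⊑-++ʳ (newBags s i) C⊑

    B-count : ∀ j → i ∸ n ≤ j → j ≤ i → s j ∸ i ≤ count (day≟ j) B
    B-count j i∸n≤j j≤i with m≤n⇒m<n∨m≡n j≤i
    ... | inj₁ j<i = begin
      s j ∸ i                                          ≤⟨ C-count j i∸n≤j j<i ⟩
      count (day≟ j) C                                 ≤⟨ m≤m+n _ _ ⟩
      count (day≟ j) C + count (day≟ j) (newBags s i)  ≡⟨ count-++ (day≟ j) C (newBags s i) ⟨
      count (day≟ j) B                                 ∎
      where open ≤-Reasoning
    ... | inj₂ refl = begin
      s i ∸ i                                               ≤⟨ m∸n≤m (s i) i ⟩
      s i                                                   ≡⟨ length-newBags s i ⟨
      length (newBags s i)                                  ≡⟨ count-all (day≟ i) (newBags s i) (day-newBags s i) ⟨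
      count (day≟ i) (newBags s i)                          ≤⟨ m≤n+m _ _ ⟩
      count (day≟ i) C + count (day≟ i) (newBags s i)       ≡⟨ count-++ (day≟ i) C (newBags s i) ⟨
      count (day≟ i) B                                      ∎
      where open ≤-Reasoning

    module Early (i<n : i < n) where

      i∸n≡0 : i ∸ n ≡ 0
      i∸n≡0 = m≤n⇒m∸n≡0 (<⇒≤ i<n)

      no-veryOld : ∀ {d} → ¬ d + n ≤ i
      no-veryOld {d} d+n≤i = <⇒≱ i<n (≤-trans (m≤n+m n d) d+n≤i)

      V≡[] : V ≡ []
      V≡[] = filter-none veryOld? {xs = B} (All.tabulate λ _ → no-veryOld)

      remembered≡B : remembered n i B ≡ B
      remembered≡B = filter-all (∁? veryOld?) {xs = B} (All.tabulate λ _ → no-veryOld)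

      r≡1 : r i ≡ 1
      r≡1 = cong (suc ∘ S) i∸n≡0

      rememberedDays≡0∷ : ∃ λ ds → rememberedDays n i ≡ 0 ∷ ds
      rememberedDays≡0∷ rewrite m≤n⇒m∸n≡0 i<n = _ , refl

      day0-nonempty : 1 ≤ length (ofDay 0 B)
      day0-nonempty = ≤-trans 1≤s0∸i (B-count 0 (≤-reflexive i∸n≡0) z≤n)
        where
        1≤s0∸i : 1 ≤ s 0 ∸ i
        1≤s0∸i = m<n⇒0<n∸m (≤-trans i<n (≤-trans (n≤1+n n) (m≤n+m (suc n) _)))

      outcomes≡ : outcomes ≡ map (_++ notOfDay 0 B) (rests 1 (ofDay 0 B))
      outcomes≡ = begin
        oldestRND r n i B
          ≡⟨ oldestRND-remembered r n i B (subst₂ _<_ (sym (cong length V≡[])) (sym r≡1) (s≤s z≤n)) ⟩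
        oldestFirst (r i ∸ length V) (rememberedDays n i) (remembered n i B)
          ≡⟨ cong (λ m → oldestFirst m (rememberedDays n i) (remembered n i B)) (cong₂ _∸_ r≡1 (cong length V≡[])) ⟩
        oldestFirst 1 (rememberedDays n i) (remembered n i B)
          ≡⟨ cong₂ (oldestFirst 1) (proj₂ rememberedDays≡0∷) remembered≡B ⟩
        oldestFirst 1 (0 ∷ proj₁ rememberedDays≡0∷) B
          ≡⟨ oldestFirst-∷ 1 0 _ B day0-nonempty ⟩
        map (_++ notOfDay 0 B) (rests 1 (ofDay 0 B))
          ∎
        where open ≡-Reasoning

      step : ∀ {C′} → C′ ∈ outcomes → Inv (suc i) C′ × (x ∈ B → x ∈ C′)
      step {C′} C′∈ with ∈-map⁻ (_++ notOfDay 0 B) (subst (C′ ∈_) outcomes≡ C′∈)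
      ... | R , R∈ , refl = (⊑-trans (∈-oldestRND⇒⊑ r n i B C′∈) B⊑ , C′-count) , keeps-x
        where
        R⊑ : R ⊑ ofDay 0 B
        R⊑ = rests-⊑ 1 (ofDay 0 B) R∈
        C′-count : ∀ j → suc i ∸ n ≤ j → j < suc i → s j ∸ suc i ≤ count (day≟ j) (R ++ notOfDay 0 B)
        C′-count zero _ _ = begin
          s 0 ∸ suc i
            ≡⟨ pred[m∸n]≡m∸[1+n] (s 0) i ⟨
          pred (s 0 ∸ i)
            ≤⟨ pred-mono-≤ (B-count 0 (≤-reflexive i∸n≡0) z≤n) ⟩
          pred (length (ofDay 0 B))
            ≡⟨ cong pred (∈-rests⇒length 1 (ofDay 0 B) R∈) ⟨
          pred (length R + 1)
            ≡⟨ cong pred (+-comm (length R) 1) ⟩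
          length R
            ≡⟨ count-all (day≟ 0) R (λ z∈ → proj₂ (∈-filter⁻ (day≟ 0) {xs = B} (⊑-∈ _≟ᵇ_ R⊑ z∈))) ⟨
          count (day≟ 0) R
            ≤⟨ m≤m+n _ _ ⟩
          count (day≟ 0) R + count (day≟ 0) (notOfDay 0 B)
            ≡⟨ count-++ (day≟ 0) R (notOfDay 0 B) ⟨
          count (day≟ 0) (R ++ notOfDay 0 B)
            ∎
          where open ≤-Reasoning
        C′-count (suc j) _ (s≤s 1+j≤i) = begin
          s (suc j) ∸ suc i
            ≤⟨ ∸-monoʳ-≤ (s (suc j)) (n≤1+n i) ⟩
          s (suc j) ∸ i
            ≤⟨ B-count (suc j) (≤-trans (≤-reflexive i∸n≡0) z≤n) 1+j≤i ⟩
          count (day≟ (suc j)) B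
            ≤⟨ count-≤-++-filter-∁ (day≟ (suc j)) (day≟ 0) (λ { refl () }) R B ⟩
          count (day≟ (suc j)) (R ++ notOfDay 0 B)
            ∎
          where open ≤-Reasoning
        keeps-x : x ∈ B → x ∈ R ++ notOfDay 0 B
        keeps-x x∈B = ∈-++⁺ʳ R (∈-filter⁺ (∁? (day≟ 0)) x∈B (λ M≡0 → <⇒≢ 1≤M (sym M≡0)))

      nonempty : 0 < length outcomes
      nonempty = subst (λ os → 0 < length os) (sym outcomes≡)
        (subst (0 <_) (sym (length-map (_++ notOfDay 0 B) (rests 1 (ofDay 0 B)))) (rests-nonempty 1 (ofDay 0 B) day0-nonempty))

    module Late (n≤i : n ≤ i) where

      rem : List Bag
      rem = remembered n i B

      V-large : 2 ^ i * r i ≤ length V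
      V-large = begin
        2 ^ i * r i
          ≤⟨ m≤m+n _ 1 ⟩
        2 ^ i * r i + 1
          ≡⟨ cong (2 ^ i * r i +_) (m+n∸n≡m 1 i) ⟨
        2 ^ i * r i + (suc i ∸ i)
          ≡⟨ +-∸-assoc (2 ^ i * r i) (n≤1+n i) ⟨
        2 ^ i * r i + suc i ∸ i
          ≡⟨ cong (λ t → 2 ^ t * r i + suc t ∸ i) (m∸n+n≡m n≤i) ⟨
        s (i ∸ n) ∸ i
          ≤⟨ B-count (i ∸ n) ≤-refl (m∸n≤m i n) ⟩
        count (day≟ (i ∸ n)) B
          ≤⟨ count-mono (day≟ (i ∸ n)) veryOld? (λ { refl → ≤-reflexive (m∸n+n≡m n≤i) }) B ⟩
        length V
          ∎
        where open ≤-Reasoning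

      r≤V : r i ≤ length V
      r≤V = ≤-trans (m≤n*m (r i) (2 ^ i) {{m^n≢0 2 i}}) V-large

      outcomes≡ : outcomes ≡ map (_++ rem) (rests (r i) V)
      outcomes≡ = oldestRND-veryOld r n i B r≤V

      nonempty : 0 < length outcomes
      nonempty = subst (λ os → 0 < length os) (sym outcomes≡)
        (subst (0 <_) (sym (length-map (_++ rem) (rests (r i) V))) (rests-nonempty (r i) V r≤V))

      step : ∀ {C′} → C′ ∈ outcomes → Inv (suc i) C′ × (x ∈ B → i < D → x ∈ C′)
      step {C′} C′∈ with ∈-map⁻ (_++ rem) (subst (C′ ∈_) outcomes≡ C′∈)
      ... | R , R∈ , refl = (⊑-trans (∈-oldestRND⇒⊑ r n i B C′∈) B⊑ , C′-count) , keeps-x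
        where
        C′-count : ∀ j → suc i ∸ n ≤ j → j < suc i → s j ∸ suc i ≤ count (day≟ j) (R ++ rem)
        C′-count j 1+i∸n≤j (s≤s j≤i) = begin
          s j ∸ suc i                ≤⟨ ∸-monoʳ-≤ (s j) (n≤1+n i) ⟩
          s j ∸ i                    ≤⟨ B-count j (≤-trans (∸-monoˡ-≤ n (n≤1+n i)) 1+i∸n≤j) j≤i ⟩
          count (day≟ j) B           ≤⟨ count-≤-++-filter-∁ (day≟ j) veryOld? (λ { refl → <⇒≱ i<j+n }) R B ⟩
          count (day≟ j) (R ++ rem)  ∎
          where
          open ≤-Reasoning
          i<j+n : i < j + n
          i<j+n = ≤-trans (≤-reflexive (sym (m∸n+n≡m (m≤n⇒m≤1+n n≤i)))) (+-monoˡ-≤ n 1+i∸n≤j)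
        keeps-x : x ∈ B → i < D → x ∈ R ++ rem
        keeps-x x∈B i<D = ∈-++⁺ʳ R (∈-filter⁺ (∁? veryOld?) x∈B (<⇒≱ i<D))

      rarely-loses-x : D ≤ i → x ∈ B → count (∁? (x ∈?_)) outcomes * 2 ^ i ≤ length outcomes
      rarely-loses-x D≤i x∈B rewrite outcomes≡ = begin
        count (∁? (x ∈?_)) (map (_++ rem) Rs) * 2 ^ i
          ≡⟨ cong (_* 2 ^ i) (count-map (∁? (x ∈?_)) (∁? (x ∈?_)) (_++ rem) (_∘ ∈-++⁺ˡ) ∉R⇒∉R++rem Rs) ⟩
        count (∁? (x ∈?_)) Rs * 2 ^ i
          ≤⟨ count-rests-∌*e≤length-rests _≟ᵇ_ (S (i ∸ n)) V (2 ^ i) x∈V x-once V-large ⟩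
        length Rs
          ≡⟨ length-map (_++ rem) Rs ⟨
        length (map (_++ rem) Rs)
          ∎
        where
        open ≤-Reasoning
        Rs : List (List Bag)
        Rs = rests (r i) V
        x∈V : x ∈ V
        x∈V = ∈-filter⁺ veryOld? x∈B D≤i
        x-once : count (x ≟ᵇ_) V ≤ 1
        x-once = ⊑-bagsBefore⇒count-x≤1 (suc i) (⊑-trans (filter-⊑ veryOld? B) B⊑)
        ∉R⇒∉R++rem : ∀ {R} → ¬ x ∈ R → ¬ x ∈ R ++ rem
        ∉R⇒∉R++rem {R} x∉R x∈ with ∈-++⁻ R x∈
        ... | inj₁ x∈R = x∉R x∈R
        ... | inj₂ x∈rem = proj₂ (∈-filter⁻ (∁? veryOld?) {xs = B} x∈rem) D≤i

    step : ∀ {C′} → C′ ∈ outcomes → Inv (suc i) C′ × (x ∈ B → i < D → x ∈ C′)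
    step C′∈ with i <? n
    ... | yes i<n = let inv′ , keeps-x = Early.step i<n C′∈ in inv′ , λ x∈B _ → keeps-x x∈B
    ... | no i≮n = Late.step (≮⇒≥ i≮n) C′∈

    nonempty : 0 < length outcomes
    nonempty with i <? n
    ... | yes i<n = Early.nonempty i<n
    ... | no i≮n = Late.nonempty (≮⇒≥ i≮n)

  -- Σ_{t ≥ D ⊔ i} 2 ^ -t: x can only be removed on a night t ≥ D, and then with probability ≤ 2 ^ -t.
  risk : ℕ → ℚ
  risk i = ½^ (D ⊔ i) ℚ.+ ½^ (D ⊔ i)

  1-risk≤1 : ∀ i → 1ℚ ℚ.- risk i ℚ.≤ 1ℚ
  1-risk≤1 i = ℚ.+-monoʳ-≤ 1ℚ (ℚ.neg-antimono-≤ (ℚ.+-mono-≤ (½^-nonNeg (D ⊔ i)) (½^-nonNeg (D ⊔ i))))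

  risk-stable : ∀ {i} → i < D → risk (suc i) ≡ risk i
  risk-stable {i} i<D = cong (λ t → ½^ t ℚ.+ ½^ t) (trans (m≥n⇒m⊔n≡m i<D) (sym (m≥n⇒m⊔n≡m (<⇒≤ i<D))))

  risk-step : ∀ {i} → D ≤ i → (1ℚ ℚ.- risk (suc i)) ℚ.- ½^ i ≡ 1ℚ ℚ.- risk i
  risk-step {i} D≤i
    rewrite m≤n⇒m⊔n≡n (m≤n⇒m≤1+n D≤i) | m≤n⇒m⊔n≡n D≤i | ½^[1+n]+½^[1+n]≡½^n i =
    solve 2 (λ o h → (o :- h) :- h := o :- (h :+ h)) refl 1ℚ (½^ i)
    where open ℚ.+-*-Solver

  present-nonNeg : ∀ C → 0ℚ ℚ.≤ present x C
  present-nonNeg C with x ∈? C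
  ... | yes _ = ℚ.*≤* (ℤ.+≤+ z≤n)
  ... | no _  = ℚ.≤-refl

  present-∈ : ∀ {C} → x ∈ C → present x C ≡ 1ℚ
  present-∈ {C} x∈C with x ∈? C
  ... | yes _ = refl
  ... | no x∉C = contradiction x∈C x∉C

  survival : ∀ N i C → Inv i C → M < N + i → (M < i → x ∈ C) →
             1ℚ ℚ.- risk i ℚ.≤ prob r s n N i C (present x)
  survival zero i C _ M<i x∈C = ℚ.≤-trans (1-risk≤1 i) (ℚ.≤-reflexive (sym (present-∈ (x∈C M<i))))
  survival (suc N) i C inv M<1+N+i x∈C = night (M ≤? i) (i <? D)
    where
    open Night i C inv
    h : List Bag → ℚ
    h C′ = prob r s n N (suc i) C′ (present x)
    h-nonNeg : ∀ C′ → 0ℚ ℚ.≤ h C′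
    h-nonNeg = prob-nonNeg r s n (present x) present-nonNeg N (suc i)
    M<N+1+i : M < N + suc i
    M<N+1+i = subst (M <_) (sym (+-suc N i)) M<1+N+i
    survival-next : ∀ {C′} → C′ ∈ outcomes → (M < suc i → x ∈ C′) → 1ℚ ℚ.- risk (suc i) ℚ.≤ h C′
    survival-next C′∈ = survival N (suc i) _ (proj₁ (step C′∈)) M<N+1+i
    x∈B : M ≤ i → x ∈ B
    x∈B M≤i with m≤n⇒m<n∨m≡n M≤i
    ... | inj₁ M<i = ∈-++⁺ˡ (x∈C M<i)
    ... | inj₂ refl = ∈-++⁺ʳ C (first-∈-newBags s M (≤-trans (s≤s z≤n) (m≤n+m _ _)))
    all-survive : i < D → (∀ {C′} → C′ ∈ outcomes → M < suc i → x ∈ C′) →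
                  1ℚ ℚ.- risk i ℚ.≤ avg (map h outcomes)
    all-survive i<D keeps-x = subst (λ ρ → 1ℚ ℚ.- ρ ℚ.≤ avg (map h outcomes)) (risk-stable i<D)
      (avg-map-≥-all h h-nonNeg _ outcomes (1-risk≤1 (suc i)) (λ C′∈ → survival-next C′∈ (keeps-x C′∈)) nonempty)
    -- x is not yet in the cave; x is remembered, so it stays; x is very old and is taken with
    -- probability at most ½^ i.
    night : Dec (M ≤ i) → Dec (i < D) → 1ℚ ℚ.- risk i ℚ.≤ avg (map h outcomes)
    night (no M≰i) _ =
      all-survive (≤-trans (≰⇒> M≰i) (m≤m+n M n)) λ _ M<1+i → contradiction (≤-pred M<1+i) M≰i
    night (yes M≤i) (yes i<D) =
      all-survive i<D λ C′∈ _ → proj₂ (step C′∈) (x∈B M≤i) i<D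
    night (yes M≤i) (no i≮D) = subst (ℚ._≤ avg (map h outcomes)) (risk-step D≤i)
      (avg-map-≥ h h-nonNeg (x ∈?_) _ (½^ i) outcomes (1-risk≤1 (suc i)) (λ C′∈ x∈C′ → survival-next C′∈ λ _ → x∈C′)
        nonempty (m*2^i≤n⇒m≤n*½^i _ _ i (rarely-loses-x D≤i (x∈B M≤i))))
      where
      D≤i : D ≤ i
      D≤i = ≮⇒≥ i≮D
      open Late (≤-trans (m≤n+m n M) D≤i) using (rarely-loses-x)

losing : ∀ n → AlmostSurelyLosing (Construction.r n) (Construction.s n) n
losing n ε 0<ε with ½^n+½^n-eventually-≤ ε 0<ε
... | K , small = x , valid , λ N M<N →
  ℚ.≤-trans 1-ε≤1-risk0 (survival N 0 [] (⊑-refl , λ _ _ ()) (subst (suc K <_) (sym (+-identityʳ N)) M<N) λ ())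
  where
  open Construction n
  open Losing n (suc K) (s≤s z≤n)
  valid : 0 < s (suc K)
  valid = ≤-trans (s≤s z≤n) (m≤n+m _ _)
  1-ε≤1-risk0 : 1ℚ ℚ.- ε ℚ.≤ 1ℚ ℚ.- risk 0
  1-ε≤1-risk0 = ℚ.+-monoʳ-≤ 1ℚ (ℚ.neg-antimono-≤
    (subst (λ t → ½^ t ℚ.+ ½^ t ℚ.≤ ε) (sym (⊔-identityʳ D)) (small D (≤-trans (n≤1+n K) (m≤m+n (suc K) n)))))

corollary3p2 : ∀ (n : ℕ) → ∃[ r ] ∃[ s ]
    ((∀ i → 1 ≤ r i × r i < s i) × SurelyWinning r s (suc n) × AlmostSurelyLosing r s n)
corollary3p2 n = r , s , 1≤r<s , Winning.winning n , losing n
  where open Construction n
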